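{- Consider a matching market with $n$ men and $n$ women in which every man has an arbitrary strict complete preference list over the women, and every woman uses as her preference list one of two strict rankings $\sigma_1,\sigma_2$ of the men. Suppose exactly $k$ women use $\sigma_1$, and the top $k$ men in $\sigma_1$ are exactly the bottom $k$ men in $\sigma_2$. Then in the woman-optimal stable matching, the women using $\sigma_1$ are matched only with these $k$ men, and the $n-k$ women using $\sigma_2$ are matched only with the other $n-k$ men.
   Context: A perfect matching $\mu$ between men and women is stable if there is no pair $(m,w)\notin\mu$ such that $m$ prefers $w$ to $\mu(m)$ and $w$ prefers $m$ to $\mu(w)$. The woman-optimal stable matching is the stable matching in which every woman is matched to her most preferred partner among all partners she has in any stable matching (it is produced by the woman-proposing deferred acceptance algorithm). -}

module Defs where

open import Data.Nat using (ℕ; _∸_) renaming (_<_ to _<ℕ_; _≤_ to _≤ℕ_)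
open import Data.Fin using (Fin; toℕ; _<_; _≤_)
open import Data.Fin.Permutation using (Permutation′; _⟨$⟩ʳ_; _⟨$⟩ˡ_)
open import Data.Fin.Subset using (Subset; Side; inside; outside)
open import Data.Vec using (lookup)
open import Data.Product using (_×_)
open import Relation.Nullary using (¬_)

-- A strict complete preference list over a set Fin n of n agents is given
-- by a ranking: a bijection from agents to positions 0..n-1
-- (position 0 = most preferred).
Ranking : ℕ → Set
Ranking n = Permutation′ n

rank : ∀ {n} → Ranking n → Fin n → Fin n
rank r x = r ⟨$⟩ʳ x

Prefers : ∀ {n} → Ranking n → Fin n → Fin n → Set
Prefers r x y = rank r x < rank r y

Matching : ℕ → Set
Matching n = Permutation′ n

partnerOfMan : ∀ {n} → Matching n → Fin n → Fin n
partnerOfMan μ m = μ ⟨$⟩ʳ m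

partnerOfWoman : ∀ {n} → Matching n → Fin n → Fin n
partnerOfWoman μ w = μ ⟨$⟩ˡ w

-- menPref m : ranking of the women by man m
-- womenPref w : ranking of the men by woman w
-- Stable: no blocking pair (m , w) (a pair in μ can never block, since
-- the strict preferences would be irreflexive).
Stable : ∀ {n} → (Fin n → Ranking n) → (Fin n → Ranking n) → Matching n → Set
Stable {n} menPref womenPref μ =
  ∀ (m w : Fin n) →
    ¬ (Prefers (menPref m) w (partnerOfMan μ m) ×
       Prefers (womenPref w) m (partnerOfWoman μ w))

WomanOptimalStable : ∀ {n} → (Fin n → Ranking n) → (Fin n → Ranking n) → Matching n → Set
WomanOptimalStable {n} menPref womenPref μ =
  Stable menPref womenPref μ ×
  (∀ (ν : Matching n) → Stable menPref womenPref ν →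
     ∀ (w : Fin n) →
       rank (womenPref w) (partnerOfWoman μ w) ≤ rank (womenPref w) (partnerOfWoman ν w))

twoTypePrefs : ∀ {n} → Subset n → Ranking n → Ranking n → Fin n → Ranking n
twoTypePrefs S σ₁ σ₂ w with lookup S w
... | inside  = σ₁
... | outside = σ₂

-- Run two independent serial dictatorships. The k men ranked highest by σ₁, in σ₁-order,
-- each take their favourite remaining woman of S; the other n − k men, who are exactly the
-- n − k ranked highest by σ₂, do the same in σ₂-order with the women outside S. The result ν
-- is stable: every woman ranks all men of her own block above all men of the other block, and
-- a man of her block who prefers her to his partner found her already taken by a man earlier
-- in the order, i.e. by a man she prefers. Woman-optimality makes μ(w) at least as good for w
-- as ν(w), which lies in the top block of her ranking, hence so does μ(w).

module Submission where

open import Defs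
open import Data.Nat using (ℕ; zero; suc; _+_; _∸_; z≤n; s≤s; _≤′_; ≤′-refl; ≤′-step)
  renaming (_<_ to _<ℕ_; _≤_ to _≤ℕ_)
import Data.Nat.Properties as ℕ
open import Data.Nat.DivMod using (_mod_; m<n⇒m%n≡m)
open import Data.Bool using (not; if_then_else_)
open import Data.Bool.Properties using (not-injective)
open import Data.Fin using (Fin; toℕ; zero; suc; fromℕ<; inject; punchOut)
open import Data.Fin.Properties
  using (_≟_; toℕ-injective; toℕ-fromℕ<; toℕ-inject; toℕ<n; all?; any?; ¬∀⟶∃¬-smallest;
         punchOut-injective; injective⇒≤)
open import Data.Fin.Subset
  using (Subset; Side; inside; outside; _∈_; _∉_; _⊆_; ∁; _-_; ∣_∣; Nonempty)
open import Data.Fin.Subset.Properties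
  using (_∈?_; drop-there; nonempty?; Empty-unique; ∣⊥∣≡0; ∣p∣≤n; p⊆q⇒∣p∣≤∣q∣;
         p─q⊆p; x∈p∧x≢y⇒x∈p-y; x∉p⇒x∈∁p; ∣∁p∣≡n∸∣p∣)
open import Data.Fin.Permutation using (_⟨$⟩ˡ_; inverseˡ; inverseʳ)
open import Data.Vec using (_∷_; lookup; tail; there)
open import Data.Vec.Properties using (lookup-map; []=⇒lookup; lookup⇒[]=)
open import Data.Product using (_×_; _,_; proj₁; proj₂; ∃-syntax)
open import Function using (_∘_)
open import Function.Bundles using (_⇔_; mk⇔; Equivalence; mk⤖)
open import Function.Definitions using (Injective; Surjective)
open import Function.Properties.Bijection using (⤖⇒↔)
open import Function.Properties.Equivalence using () renaming (trans to ⇔-trans)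
open import Relation.Binary.Definitions using (tri<; tri≈; tri>)
open import Relation.Binary.PropositionalEquality
  using (_≡_; _≢_; refl; sym; trans; cong; subst; subst₂; module ≡-Reasoning)
open import Relation.Nullary using (¬_; yes; no; ¬?; contradiction)
open import Relation.Nullary.Decidable using (decidable-stable)
open import Relation.Unary using (Decidable)

open Equivalence using (to; from)

private
  variable
    n : ℕ

∣p∣≤1+∣p-x∣ : ∀ (p : Subset n) x → ∣ p ∣ ≤ℕ suc ∣ p - x ∣
∣p∣≤1+∣p-x∣ (s ∷ p) zero =
  ℕ.≤-trans (∣s∷p∣≤1+∣p∣ s) (s≤s (p⊆q⇒∣p∣≤∣q∣ p⊆tail))
  where
  ∣s∷p∣≤1+∣p∣ : ∀ s → ∣ s ∷ p ∣ ≤ℕ suc ∣ p ∣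
  ∣s∷p∣≤1+∣p∣ inside  = ℕ.≤-refl
  ∣s∷p∣≤1+∣p∣ outside = ℕ.n≤1+n _
  p⊆tail : p ⊆ tail ((s ∷ p) - zero)
  p⊆tail x∈p = drop-there (x∈p∧x≢y⇒x∈p-y {p = s ∷ p} {y = zero} (there x∈p) λ ())
∣p∣≤1+∣p-x∣ (inside  ∷ p) (suc x) = s≤s (∣p∣≤1+∣p-x∣ p x)
∣p∣≤1+∣p-x∣ (outside ∷ p) (suc x) = ∣p∣≤1+∣p-x∣ p x

x∉p-x : ∀ (p : Subset n) x → x ∉ p - x
x∉p-x (_ ∷ p) zero    ()
x∉p-x (_ ∷ p) (suc x) (there x∈p-x) = x∉p-x p x x∈p-x

0<∣p∣⇒Nonempty : ∀ {n} (p : Subset n) → 0 <ℕ ∣ p ∣ → Nonempty p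
0<∣p∣⇒Nonempty {n} p 0<∣p∣ with nonempty? p
... | yes p≠∅ = p≠∅
... | no  p=∅ =
  contradiction (trans (cong ∣_∣ (Empty-unique p=∅)) (∣⊥∣≡0 n)) (ℕ.>⇒≢ 0<∣p∣)

fibre : Subset n → Side → Subset n
fibre p b = if b then p else ∁ p

∈-fibre : ∀ (p : Subset n) b {x} → x ∈ fibre p b ⇔ lookup p x ≡ b
∈-fibre p inside      = mk⇔ []=⇒lookup (lookup⇒[]= _ p)
∈-fibre p outside {x} = mk⇔
  (λ x∈∁p → not-injective (trans (sym (lookup-map x not p)) ([]=⇒lookup x∈∁p)))
  (λ px≡outside → lookup⇒[]= x (∁ p) (trans (lookup-map x not p) (cong not px≡outside)))

injective⇒surjective : ∀ {n} {f : Fin n → Fin n} →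
                       Injective _≡_ _≡_ f → Surjective _≡_ _≡_ f
injective⇒surjective {suc n} {f} f-inj y with any? (λ x → f x ≟ y)
... | yes (x , fx≡y) = x , λ { refl → fx≡y }
... | no  y∉image    = contradiction (injective⇒≤ g-inj) (ℕ.n≮n n)
  where
  y≢f : ∀ x → y ≢ f x
  y≢f x y≡fx = y∉image (x , sym y≡fx)
  g : Fin (suc n) → Fin n
  g x = punchOut (y≢f x)
  g-inj : Injective _≡_ _≡_ g
  g-inj {a} {b} = f-inj ∘ punchOut-injective (y≢f a) (y≢f b)

toℕ-mod : ∀ {j} → j <ℕ suc n → toℕ (j mod suc n) ≡ j
toℕ-mod j<1+n = trans (toℕ-fromℕ< _) (m<n⇒m%n≡m j<1+n)

mod-toℕ : ∀ (i : Fin (suc n)) → toℕ i mod suc n ≡ i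
mod-toℕ i = toℕ-injective (toℕ-mod (toℕ<n i))

inject-fromℕ< : ∀ {i x : Fin n} (x<i : toℕ x <ℕ toℕ i) → inject (fromℕ< x<i) ≡ x
inject-fromℕ< x<i = toℕ-injective (trans (toℕ-inject (fromℕ< x<i)) (toℕ-fromℕ< x<i))

rank-injective : ∀ (r : Ranking n) {x y} → rank r x ≡ rank r y → x ≡ y
rank-injective r rx≡ry = trans (sym (inverseˡ r)) (trans (cong (r ⟨$⟩ˡ_) rx≡ry) (inverseˡ r))

module _ (r : Ranking (suc n)) (p : Subset (suc n)) where

  private
    Unoccupied : Fin (suc n) → Set
    Unoccupied i = r ⟨$⟩ˡ i ∉ p

    unoccupied? : Decidable Unoccupied
    unoccupied? i = ¬? (r ⟨$⟩ˡ i ∈? p)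

    at-own-rank : ∀ {x} → x ∈ p → r ⟨$⟩ˡ rank r x ∈ p
    at-own-rank = subst (_∈ p) (sym (inverseˡ r))

    occupied : ∀ {x} → x ∈ p → ¬ (∀ i → Unoccupied i)
    occupied {x} x∈p all = all (rank r x) (at-own-rank x∈p)

  best : Fin (suc n)
  best with all? unoccupied?
  ... | yes _    = zero
  ... | no  ¬all = r ⟨$⟩ˡ proj₁ (¬∀⟶∃¬-smallest _ Unoccupied unoccupied? ¬all)

  best-∈ : ∀ {x} → x ∈ p → best ∈ p
  best-∈ x∈p with all? unoccupied?
  ... | yes all  = contradiction all (occupied x∈p)
  ... | no  ¬all =
    decidable-stable (_ ∈? p) (proj₁ (proj₂ (¬∀⟶∃¬-smallest _ Unoccupied unoccupied? ¬all)))

  best-optimal : ∀ {x} → x ∈ p → ¬ Prefers r x best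
  best-optimal {x} x∈p with all? unoccupied?
  ... | yes all  = contradiction all (occupied x∈p)
  ... | no  ¬all with ¬∀⟶∃¬-smallest _ Unoccupied unoccupied? ¬all
  ...   | i , _ , earlier-unoccupied = λ x≻best →
    let x<i = subst (λ k → toℕ (rank r x) <ℕ toℕ k) (inverseʳ r) x≻best
    in  earlier-unoccupied (fromℕ< x<i)
          (subst (λ k → r ⟨$⟩ˡ k ∈ p) (sym (inject-fromℕ< x<i)) (at-own-rank x∈p))

module SerialDictatorship {n : ℕ} (chooser : ℕ → Ranking (suc n)) (W : Subset (suc n)) where

  available : ℕ → Subset (suc n)
  pick : ℕ → Fin (suc n)
  available zero    = W
  available (suc j) = available j - pick j
  pick j = best (chooser j) (available j)

  ∣W∣≤j+∣available∣ : ∀ j → ∣ W ∣ ≤ℕ j + ∣ available j ∣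
  ∣W∣≤j+∣available∣ zero    = ℕ.≤-refl
  ∣W∣≤j+∣available∣ (suc j) = begin
    ∣ W ∣                          ≤⟨ ∣W∣≤j+∣available∣ j ⟩
    j + ∣ available j ∣            ≤⟨ ℕ.+-monoʳ-≤ j (∣p∣≤1+∣p-x∣ (available j) (pick j)) ⟩
    j + suc ∣ available (suc j) ∣  ≡⟨ ℕ.+-suc j _ ⟩
    suc j + ∣ available (suc j) ∣  ∎
    where open ℕ.≤-Reasoning

  available-nonempty : ∀ {j} → j <ℕ ∣ W ∣ → Nonempty (available j)
  available-nonempty {j} j<∣W∣ = 0<∣p∣⇒Nonempty (available j) (ℕ.<-≤-trans
    (ℕ.m<n⇒0<n∸m j<∣W∣) (ℕ.m≤n+o⇒m∸n≤o ∣ W ∣ j (∣W∣≤j+∣available∣ j)))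

  pick-∈-available : ∀ {j} → j <ℕ ∣ W ∣ → pick j ∈ available j
  pick-∈-available {j} j<∣W∣ =
    best-∈ (chooser j) (available j) (proj₂ (available-nonempty j<∣W∣))

  available-⊆ : ∀ {i j} → i ≤′ j → available j ⊆ available i
  available-⊆ ≤′-refl         x∈ = x∈
  available-⊆ (≤′-step i≤′j) x∈ = available-⊆ i≤′j (p─q⊆p _ _ x∈)

  pick-∈ : ∀ {j} → j <ℕ ∣ W ∣ → pick j ∈ W
  pick-∈ {j} j<∣W∣ = available-⊆ {j = j} (ℕ.≤⇒≤′ z≤n) (pick-∈-available j<∣W∣)

  picked-unavailable : ∀ {i j} → i <ℕ j → pick i ∉ available j
  picked-unavailable {i} i<j =
    x∉p-x (available i) (pick i) ∘ available-⊆ (ℕ.≤⇒≤′ i<j)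

  pick-injective : ∀ {i j} → i <ℕ ∣ W ∣ → j <ℕ ∣ W ∣ → pick i ≡ pick j → i ≡ j
  pick-injective {i} {j} i<∣W∣ j<∣W∣ pᵢ≡pⱼ with ℕ.<-cmp i j
  ... | tri< i<j _ _ = contradiction
    (subst (_∈ available j) (sym pᵢ≡pⱼ) (pick-∈-available j<∣W∣)) (picked-unavailable i<j)
  ... | tri≈ _ i≡j _ = i≡j
  ... | tri> _ _ j<i = contradiction
    (subst (_∈ available i) pᵢ≡pⱼ (pick-∈-available i<∣W∣)) (picked-unavailable j<i)

  unavailable⇒picked : ∀ j {v} → v ∈ W → v ∉ available j → ∃[ i ] i <ℕ j × pick i ≡ v
  unavailable⇒picked zero    v∈W v∉ = contradiction v∈W v∉
  unavailable⇒picked (suc j) {v} v∈W v∉ with v ∈? available j | v ≟ pick j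
  ... | no  v∉ⱼ | _       =
    let i , i<j , pᵢ≡v = unavailable⇒picked j v∈W v∉ⱼ in i , ℕ.m<n⇒m<1+n i<j , pᵢ≡v
  ... | yes _   | yes v≡pⱼ = j , ℕ.n<1+n j , sym v≡pⱼ
  ... | yes v∈ⱼ | no  v≢pⱼ = contradiction (x∈p∧x≢y⇒x∈p-y v∈ⱼ v≢pⱼ) v∉

  pick-best : ∀ {j v} → j <ℕ ∣ W ∣ → v ∈ W → Prefers (chooser j) v (pick j) →
              ∃[ i ] i <ℕ j × pick i ≡ v
  pick-best {j} _ v∈W v≻pⱼ =
    unavailable⇒picked j v∈W (λ v∈ → best-optimal (chooser j) (available j) v∈ v≻pⱼ)

module TwoBlockMarket {n : ℕ}
    (menPref womenPref : Fin (suc n) → Ranking (suc n))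
    (S : Subset (suc n)) (σ : Side → Ranking (suc n))
    (womenPref-by-block : ∀ w → womenPref w ≡ σ (lookup S w))
    (block : Fin (suc n) → Side)
    (block⇔top : ∀ b m → block m ≡ b ⇔ toℕ (rank (σ b) m) <ℕ ∣ fibre S b ∣)
  where

  position : Side → Fin (suc n) → ℕ
  position b m = toℕ (rank (σ b) m)

  -- Only positions below suc n are ever used; mod merely makes manAt total.
  manAt : Side → ℕ → Fin (suc n)
  manAt b j = σ b ⟨$⟩ˡ (j mod suc n)

  manAt-position : ∀ b m → manAt b (position b m) ≡ m
  manAt-position b m = trans (cong (σ b ⟨$⟩ˡ_) (mod-toℕ _)) (inverseˡ (σ b))

  position-manAt : ∀ b {j} → j <ℕ ∣ fibre S b ∣ → position b (manAt b j) ≡ j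
  position-manAt b j<quota =
    trans (cong toℕ (inverseʳ (σ b))) (toℕ-mod (ℕ.<-≤-trans j<quota (∣p∣≤n (fibre S b))))

  in-top : ∀ {b m} → block m ≡ b → position b m <ℕ ∣ fibre S b ∣
  in-top {b} {m} = to (block⇔top b m)

  module Draft (b : Side) = SerialDictatorship (menPref ∘ manAt b) (fibre S b)
  open Draft using (pick; pick-∈; pick-injective; pick-best)

  partner : Fin (suc n) → Fin (suc n)
  partner m = pick (block m) (position (block m) m)

  partner-in-block : ∀ {b m} → block m ≡ b → partner m ≡ pick b (position b m)
  partner-in-block refl = refl

  block-partner : ∀ m → lookup S (partner m) ≡ block m
  block-partner m = to (∈-fibre S (block m)) (pick-∈ (block m) (in-top refl))

  partner-injective : Injective _≡_ _≡_ partner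
  partner-injective {a} {c} pa≡pc =
    rank-injective (σ b) (toℕ-injective (pick-injective b (in-top refl) (in-top c-in-b) picks-equal))
    where
    b = block a
    c-in-b : block c ≡ b
    c-in-b = trans (sym (block-partner c)) (trans (cong (lookup S) (sym pa≡pc)) (block-partner a))
    picks-equal : pick b (position b a) ≡ pick b (position b c)
    picks-equal = trans pa≡pc (partner-in-block c-in-b)

  -- Opaque, so that the type checker never unfolds the inverse found by injective⇒surjective.
  opaque
    ν : Matching (suc n)
    ν = ⤖⇒↔ (mk⤖ (partner-injective , injective⇒surjective partner-injective))

  opaque
    unfolding ν
    partnerOfMan-ν : ∀ m → partnerOfMan ν m ≡ partner m
    partnerOfMan-ν m = refl

  husband : Fin (suc n) → Fin (suc n)
  husband = partnerOfWoman ν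

  partner-husband : ∀ w → partner (husband w) ≡ w
  partner-husband w = trans (sym (partnerOfMan-ν (husband w))) (inverseʳ ν)

  block-husband : ∀ w → block (husband w) ≡ lookup S w
  block-husband w = trans (sym (block-partner (husband w))) (cong (lookup S) (partner-husband w))

  husband-pick : ∀ b {j} → j <ℕ ∣ fibre S b ∣ → husband (pick b j) ≡ manAt b j
  husband-pick b {j} j<quota =
    partner-injective (trans (partner-husband (pick b j)) (sym (begin
      partner (manAt b j)               ≡⟨ partner-in-block (from (block⇔top b _) position<quota) ⟩
      pick b (position b (manAt b j))   ≡⟨ cong (pick b) position≡j ⟩
      pick b j                          ∎)))
    where
    open ≡-Reasoning
    position≡j = position-manAt b j<quota
    position<quota = subst (_<ℕ ∣ fibre S b ∣) (sym position≡j) j<quota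

  ν-stable : Stable menPref womenPref ν
  ν-stable m w (m≻w , w≻m) = ℕ.<-asym m<husband husband<m
    where
    b = lookup S w
    m<husband : position b m <ℕ position b (husband w)
    m<husband = subst (λ r → Prefers r m (husband w)) (womenPref-by-block w) w≻m
    m-in-b : block m ≡ b
    m-in-b = from (block⇔top b m) (ℕ.<-trans m<husband (in-top (block-husband w)))
    m≻w′ : Prefers (menPref (manAt b (position b m))) w (pick b (position b m))
    m≻w′ = subst₂ (λ r p → Prefers r w p)
             (cong menPref (sym (manAt-position b m)))
             (trans (partnerOfMan-ν m) (partner-in-block m-in-b)) m≻w
    husband<m : position b (husband w) <ℕ position b m
    husband<m with i , i<m , pᵢ≡w ← pick-best b (in-top m-in-b) (from (∈-fibre S b) refl) m≻w′ =
      subst (_<ℕ position b m) (sym position≡i) i<m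
      where
      i<quota = ℕ.<-trans i<m (in-top m-in-b)
      position≡i : position b (husband w) ≡ i
      position≡i = begin
        position b (husband w)          ≡⟨ cong (position b ∘ husband) (sym pᵢ≡w) ⟩
        position b (husband (pick b i)) ≡⟨ cong (position b) (husband-pick b i<quota) ⟩
        position b (manAt b i)          ≡⟨ position-manAt b i<quota ⟩
        i                               ∎
        where open ≡-Reasoning

  womanOptimal⇒sameBlock : ∀ μ → WomanOptimalStable menPref womenPref μ →
                           ∀ w → block (partnerOfWoman μ w) ≡ lookup S w
  womanOptimal⇒sameBlock μ (_ , optimal) w =
    from (block⇔top b m) (ℕ.≤-<-trans atLeastAsGood (in-top (block-husband w)))
    where
    b = lookup S w
    m = partnerOfWoman μ w
    atLeastAsGood : position b m ≤ℕ position b (husband w)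
    atLeastAsGood = subst (λ r → toℕ (rank r m) ≤ℕ toℕ (rank r (husband w)))
                          (womenPref-by-block w) (optimal ν ν-stable w)

twoTypePrefs-by-block : ∀ (S : Subset n) σ₁ σ₂ w →
                        twoTypePrefs S σ₁ σ₂ w ≡ (if lookup S w then σ₁ else σ₂)
twoTypePrefs-by-block S σ₁ σ₂ w with lookup S w
... | inside  = refl
... | outside = refl

module ComplementaryBlocks {n k : ℕ} (σ₁ σ₂ : Ranking n)
    (S : Subset n) (∣S∣≡k : ∣ S ∣ ≡ k)
    (top⇔bottom : ∀ m → toℕ (rank σ₁ m) <ℕ k ⇔ n ∸ k ≤ℕ toℕ (rank σ₂ m))
  where

  block : Fin n → Side
  block m with toℕ (rank σ₁ m) ℕ.<? k
  ... | yes _ = inside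
  ... | no  _ = outside

  block-inside : ∀ m → block m ≡ inside ⇔ toℕ (rank σ₁ m) <ℕ k
  block-inside m with toℕ (rank σ₁ m) ℕ.<? k
  ... | yes r<k = mk⇔ (λ _ → r<k) (λ _ → refl)
  ... | no  r≮k = mk⇔ (λ ()) (λ r<k → contradiction r<k r≮k)

  block-outside : ∀ m → block m ≡ outside ⇔ k ≤ℕ toℕ (rank σ₁ m)
  block-outside m with toℕ (rank σ₁ m) ℕ.<? k
  ... | yes r<k = mk⇔ (λ ()) (λ k≤r → contradiction r<k (ℕ.≤⇒≯ k≤r))
  ... | no  r≮k = mk⇔ (λ _ → ℕ.≮⇒≥ r≮k) (λ _ → refl)

  bottom₁⇔top₂ : ∀ m → k ≤ℕ toℕ (rank σ₁ m) ⇔ toℕ (rank σ₂ m) <ℕ ∣ ∁ S ∣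
  bottom₁⇔top₂ m = mk⇔
    (λ k≤r₁ → subst (_ <ℕ_) (sym ∣∁S∣≡n∸k)
                (ℕ.≰⇒> (ℕ.≤⇒≯ k≤r₁ ∘ from (top⇔bottom m))))
    (λ r₂<∣∁S∣ → ℕ.≮⇒≥
                (ℕ.<⇒≱ (subst (_ <ℕ_) ∣∁S∣≡n∸k r₂<∣∁S∣) ∘ to (top⇔bottom m)))
    where
    ∣∁S∣≡n∸k : ∣ ∁ S ∣ ≡ n ∸ k
    ∣∁S∣≡n∸k = trans (∣∁p∣≡n∸∣p∣ S) (cong (n ∸_) ∣S∣≡k)

  block⇔top : ∀ b m → block m ≡ b ⇔ toℕ (rank (if b then σ₁ else σ₂) m) <ℕ ∣ fibre S b ∣
  block⇔top inside  m = subst (λ c → block m ≡ inside ⇔ _ <ℕ c) (sym ∣S∣≡k) (block-inside m)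
  block⇔top outside m = ⇔-trans (block-outside m) (bottom₁⇔top₂ m)

lemma3 : ∀ (n k : ℕ) (menPref : Fin n → Ranking n) (σ₁ σ₂ : Ranking n)
    (S : Subset n) → ∣ S ∣ ≡ k →
    (∀ (m : Fin n) → (toℕ (rank σ₁ m) <ℕ k) ⇔ (n ∸ k ≤ℕ toℕ (rank σ₂ m))) →
    ∀ (μ : Matching n) → WomanOptimalStable menPref (twoTypePrefs S σ₁ σ₂) μ →
    ∀ (w : Fin n) →
    (w ∈ S → toℕ (rank σ₁ (partnerOfWoman μ w)) <ℕ k) ×
    (w ∉ S → k ≤ℕ toℕ (rank σ₁ (partnerOfWoman μ w)))
lemma3 zero    _ _       _  _  _ _     _          _ _         ()
lemma3 (suc n) k menPref σ₁ σ₂ S ∣S∣≡k top⇔bottom μ μ-optimal w =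
    (λ w∈S → to (block-inside m) (trans same-block ([]=⇒lookup w∈S)))
  , (λ w∉S → to (block-outside m)
                 (trans same-block (to (∈-fibre S outside) (x∉p⇒x∈∁p w∉S))))
  where
  open ComplementaryBlocks σ₁ σ₂ S ∣S∣≡k top⇔bottom
  open TwoBlockMarket menPref (twoTypePrefs S σ₁ σ₂) S (λ b → if b then σ₁ else σ₂)
                      (twoTypePrefs-by-block S σ₁ σ₂) block block⇔top
  m = partnerOfWoman μ w
  same-block : block m ≡ lookup S w
  same-block = womanOptimal⇒sameBlock μ μ-optimal w
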